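{- Let $G$ be a finite group, let $S\subseteq G$ be a generating set with $S=S^{ -1}$, and let $K\le G$ be a subgroup of index $2$ with $K\cap S=\emptyset$. Fix $s_0\in S$. Let $H$ be a group and $\theta:H\to\mathrm{Aut}(G)$, $h\mapsto\theta_h$, a homomorphism such that $\theta_h(S)=S$ for all $h\in H$ and the induced action of $H$ on $S$ is simply transitive. (Then $\theta_h(K)=K$ for all $h$, so the semidirect product $K\rtimes_\theta H$ is defined, with multiplication $(k_1,h_1)(k_2,h_2)=(k_1\theta_{h_1}(k_2),h_1h_2)$.) Let $T\subseteq H$. Define the directed graph $X=\mathrm{Cay}(K\rtimes_\theta H,\Sigma_1^T\cup\Sigma_2^T)$, with vertex set $K\rtimes_\theta H$ and an edge $(x,x\sigma)$ for every $x\in K\rtimes_\theta H$ and $\sigma\in\Sigma_1^T\cup\Sigma_2^T$, where $\Sigma_1^T=\{(1_K,t):t\in T\}$ and $\Sigma_2^T=\{(s_0\theta_t(s_0^{ -1}),t):t\in T\}$. Define the directed graph $\Gamma$ as follows. Its vertex set is the set $E$ of undirected edges of $\mathrm{Cay}(G,S)$, where each such edge is written as the ordered pair $(a,b)$ with $a\in K$, $b\in Ks_0$, $a^{ -1}b\in S$. For $g\in G$ let $e_g:H\to E$ be given by $e_g(h)=(g,g\theta_h(s_0))$ if $g\in K$ and $e_g(h)=(g\theta_h(s_0^{ -1}),g)$ if $g\in Ks_0$. The edge set of $\Gamma$ is $\{(e_g(h),e_g(ht)):g\in G,h\in H,t\in T\}$. Then the map $f:K\rtimes_\theta H\to E$,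 $f((k,h))=(k,k\theta_h(s_0))$, is a bijection and a graph isomorphism from $X$ to $\Gamma$.
   Context: For a group $G$ and $S\subseteq G$ with $S=S^{ -1}$, the Cayley graph $\mathrm{Cay}(G,S)$ is the graph with vertex set $G$ in which $g$ and $gs$ are adjacent for all $g\in G$, $s\in S$. Since $K$ has index 2 and is disjoint from $S$, $\mathrm{Cay}(G,S)$ is bipartite with sides $K$ and $Ks_0$, so every undirected edge has exactly one endpoint in $K$ and one in $Ks_0$. A graph isomorphism of directed graphs is a bijection on vertices mapping the edge set bijectively onto the edge set. -}

module Defs where

open import Level using (0ℓ)
open import Algebra.Bundles using (Group)
open import Algebra.Morphism.Structures using (module GroupMorphisms)
open import Data.Product using (Σ; ∃; _×_; _,_; proj₁; proj₂)
open import Data.Sum using (_⊎_)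
open import Data.Empty using (⊥)
open import Data.List using (List; foldr)
open import Data.List.Relation.Unary.All using (All)
open import Data.Nat using (ℕ)
open import Data.Fin using (Fin)
open import Function.Bundles using (Bijection)
open import Function.Definitions using (Congruent; Bijective)
open import Relation.Nullary using (¬_)
open import Relation.Unary using (Pred)
import Relation.Binary.PropositionalEquality as ≡

module _ (G : Group 0ℓ 0ℓ) where
  open Group G

  Respects : Pred Carrier 0ℓ → Set
  Respects P = ∀ {x y} → x ≈ y → P x → P y

  IsFiniteGroup : Set
  IsFiniteGroup = Σ ℕ λ n → Bijection setoid (≡.setoid (Fin n))

  IsSymmetric : Pred Carrier 0ℓ → Set
  IsSymmetric S = ∀ x → S x → S (x ⁻¹)

  Generates : Pred Carrier 0ℓ → Set
  Generates S = ∀ g → Σ (List Carrier) λ xs → All S xs × (g ≈ foldr _∙_ ε xs)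

  record IsSubgroup (K : Pred Carrier 0ℓ) : Set where
    field
      respects : Respects K
      ε∈       : K ε
      ∙∈       : ∀ {x y} → K x → K y → K (x ∙ y)
      ⁻¹∈      : ∀ {x} → K x → K (x ⁻¹)

  -- K has exactly two right cosets: K and Kg for some g ∉ K
  HasIndex2 : Pred Carrier 0ℓ → Set
  HasIndex2 K = Σ Carrier λ g → ¬ K g × (∀ x → K x ⊎ K (x ∙ g ⁻¹))

  Disjoint : Pred Carrier 0ℓ → Pred Carrier 0ℓ → Set
  Disjoint K S = ∀ x → K x → S x → ⊥

module _ (G H : Group 0ℓ 0ℓ) where
  private
    module G = Group G
    module H = Group H
  open GroupMorphisms G.rawGroup G.rawGroup using (IsGroupIsomorphism)

  IsAutAction : (H.Carrier → G.Carrier → G.Carrier) → Set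
  IsAutAction θ =
      (∀ h → IsGroupIsomorphism (θ h))
    × (∀ {h h'} x → h H.≈ h' → θ h x G.≈ θ h' x)
    × (∀ h₁ h₂ x → θ (h₁ H.∙ h₂) x G.≈ θ h₁ (θ h₂ x))

  PreservesSet : (H.Carrier → G.Carrier → G.Carrier) → Pred G.Carrier 0ℓ → Set
  PreservesSet θ S = ∀ h →
      (∀ x → S x → S (θ h x))
    × (∀ y → S y → Σ G.Carrier λ x → S x × (θ h x G.≈ y))

  SimplyTransitiveOn : (H.Carrier → G.Carrier → G.Carrier) → Pred G.Carrier 0ℓ → Set
  SimplyTransitiveOn θ S = ∀ s s' → S s → S s' →
      (Σ H.Carrier λ h → θ h s G.≈ s')
    × (∀ h h' → θ h s G.≈ s' → θ h' s G.≈ s' → h H.≈ h')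

module Construction (G H : Group 0ℓ 0ℓ)
                    (θ : Group.Carrier H → Group.Carrier G → Group.Carrier G)
                    (K S : Pred (Group.Carrier G) 0ℓ)
                    (s₀ : Group.Carrier G)
                    (T : Pred (Group.Carrier H) 0ℓ) where
  private
    module G = Group G
    module H = Group H
  open G using (_∙_; _⁻¹; ε)

  InKs₀ : Pred G.Carrier 0ℓ
  InKs₀ b = K (b ∙ s₀ ⁻¹)

  _≈GH_ : (G.Carrier × H.Carrier) → (G.Carrier × H.Carrier) → Set
  (k , h) ≈GH (k' , h') = (k G.≈ k') × (h H.≈ h')

  smul : (G.Carrier × H.Carrier) → (G.Carrier × H.Carrier) → (G.Carrier × H.Carrier)
  smul (k₁ , h₁) (k₂ , h₂) = (k₁ ∙ θ h₁ k₂ , h₁ H.∙ h₂)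

  VX : Set
  VX = Σ G.Carrier λ k → K k × H.Carrier

  embX : VX → G.Carrier × H.Carrier
  embX (k , _ , h) = (k , h)

  _≈X_ : VX → VX → Set
  x ≈X y = embX x ≈GH embX y

  Σ₁ : Pred (G.Carrier × H.Carrier) 0ℓ
  Σ₁ σ = Σ H.Carrier λ t → T t × (σ ≈GH (ε , t))

  Σ₂ : Pred (G.Carrier × H.Carrier) 0ℓ
  Σ₂ σ = Σ H.Carrier λ t → T t × (σ ≈GH (s₀ ∙ θ t (s₀ ⁻¹) , t))

  EdgeX : VX → VX → Set
  EdgeX x y = Σ (G.Carrier × H.Carrier) λ σ →
    (Σ₁ σ ⊎ Σ₂ σ) × (embX y ≈GH smul (embX x) σ)

  _≈GG_ : (G.Carrier × G.Carrier) → (G.Carrier × G.Carrier) → Set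
  (a , b) ≈GG (a' , b') = (a G.≈ a') × (b G.≈ b')

  VΓ : Set
  VΓ = Σ (G.Carrier × G.Carrier) λ p →
    K (proj₁ p) × InKs₀ (proj₂ p) × S (proj₁ p ⁻¹ ∙ proj₂ p)

  pairΓ : VΓ → G.Carrier × G.Carrier
  pairΓ = proj₁

  _≈Γ_ : VΓ → VΓ → Set
  u ≈Γ v = pairΓ u ≈GG pairΓ v

  -- graph of e_g : H → E, i.e.  e_g(h) = p
  eRel : G.Carrier → H.Carrier → (G.Carrier × G.Carrier) → Set
  eRel g h p = (K g × (p ≈GG (g , g ∙ θ h s₀)))
             ⊎ (InKs₀ g × (p ≈GG (g ∙ θ h (s₀ ⁻¹) , g)))

  EdgeΓ : VΓ → VΓ → Set
  EdgeΓ u v = Σ G.Carrier λ g → Σ H.Carrier λ h → Σ H.Carrier λ t →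
    T t × eRel g h (pairΓ u) × eRel g (h H.∙ t) (pairΓ v)

  IsGraphIso : (VX → VΓ) → Set
  IsGraphIso f = Congruent _≈X_ _≈Γ_ f × Bijective _≈X_ _≈Γ_ f
    × (∀ x y → (EdgeX x y → EdgeΓ (f x) (f y)) × (EdgeΓ (f x) (f y) → EdgeX x y))

module Submission where

open import Defs
open import Level using (0ℓ)
open import Algebra.Bundles using (Group)
open import Algebra.Morphism.Structures using (module GroupMorphisms)
import Algebra.Properties.Group as GroupProperties
open import Data.Product using (Σ; _×_; _,_; proj₁; proj₂)
open import Data.Sum using (inj₁; inj₂)
open import Data.Empty using (⊥; ⊥-elim)
open import Function.Definitions using (Congruent; Injective; Surjective)
open import Relation.Nullary using (¬_)
open import Relation.Unary using (Pred)
import Relation.Binary.Reasoning.Setoid as SetoidReasoning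

-- By simple transitivity h ↦ θ_h(s₀) is a bijection H → S, so (k, h) ↦ (k, k θ_h(s₀))
-- enumerates the edges of Cay(G,S) by their K-endpoint and their direction.
-- Both generators act on the direction by h ↦ ht: (1, t) keeps the K-endpoint k,
-- while (s₀ θ_t(s₀⁻¹), t) keeps the Ks₀-endpoint g = k θ_h(s₀), since
-- k θ_h(s₀ θ_t(s₀⁻¹)) = g θ_{ht}(s₀⁻¹).  These are exactly the steps e_g(h) → e_g(ht),
-- the two cases being told apart by the side of g, as K and Ks₀ are disjoint.

module SubgroupProperties (G : Group 0ℓ 0ℓ) {K : Pred (Group.Carrier G) 0ℓ}
                          (K-subgroup : IsSubgroup G K) where
  open Group G
  open GroupProperties G
  open IsSubgroup K-subgroup

  ∙⁻¹∈⇒∈ : ∀ {g x} → K g → K (g ∙ x ⁻¹) → K x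
  ∙⁻¹∈⇒∈ {g} {x} g∈K gx⁻¹∈K =
    respects (⁻¹-involutive x) (⁻¹∈ (respects (\\-leftDividesʳ g (x ⁻¹)) (∙∈ (⁻¹∈ g∈K) gx⁻¹∈K)))

  ∉-index2⇒∙⁻¹∈ : HasIndex2 G K → ∀ {x y} → ¬ K x → ¬ K y → K (x ∙ y ⁻¹)
  ∉-index2⇒∙⁻¹∈ (g , _ , cosets) {x} {y} x∉K y∉K =
    respects quotient (∙∈ (∈Kg x∉K) (⁻¹∈ (∈Kg y∉K)))
    where
    ∈Kg : ∀ {z} → ¬ K z → K (z // g)
    ∈Kg {z} z∉K with cosets z
    ... | inj₁ z∈K    = ⊥-elim (z∉K z∈K)
    ... | inj₂ zg⁻¹∈K = zg⁻¹∈K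

    quotient : (x // g) ∙ (y // g) ⁻¹ ≈ x ∙ y ⁻¹
    quotient = begin
      (x // g) ∙ (y // g) ⁻¹      ≈⟨ ∙-congˡ (⁻¹-anti-homo-// y g) ⟩
      (x // g) ∙ (g // y)        ≈⟨ assoc x (g ⁻¹) (g ∙ y ⁻¹) ⟩
      x ∙ (g ⁻¹ ∙ (g ∙ y ⁻¹))    ≈⟨ ∙-congˡ (\\-leftDividesʳ g (y ⁻¹)) ⟩
      x ∙ y ⁻¹                   ∎
      where open SetoidReasoning setoid

module AutActionProperties (G H : Group 0ℓ 0ℓ)
                           {θ : Group.Carrier H → Group.Carrier G → Group.Carrier G}
                           (action : IsAutAction G H θ) where
  private module H = Group H
  open Group G
  open GroupProperties G using (x≈z//y; //-rightDividesˡ)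
  open GroupMorphisms rawGroup rawGroup using (module IsGroupIsomorphism)

  module _ (h : H.Carrier) where
    open IsGroupIsomorphism (proj₁ action h) public
      using ()
      renaming (⟦⟧-cong to θ-cong; ∙-homo to θ-∙-homo; ε-homo to θ-ε-homo; ⁻¹-homo to θ-⁻¹-homo)

  θ-congʰ : ∀ {h h'} x → h H.≈ h' → θ h x ≈ θ h' x
  θ-congʰ = proj₁ (proj₂ action)

  θ-∙ʰ-homo : ∀ h₁ h₂ x → θ (h₁ H.∙ h₂) x ≈ θ h₁ (θ h₂ x)
  θ-∙ʰ-homo = proj₂ (proj₂ action)

  ≈∙θ⁻¹⇒∙θ≈ : ∀ {k g} h x → k ≈ g ∙ θ h (x ⁻¹) → k ∙ θ h x ≈ g
  ≈∙θ⁻¹⇒∙θ≈ {g = g} h x k≈ =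
    trans (∙-congʳ (trans k≈ (∙-congˡ (θ-⁻¹-homo h x)))) (//-rightDividesˡ (θ h x) g)

  ∙θ≈⇒≈∙θ⁻¹ : ∀ {k g} h x → k ∙ θ h x ≈ g → k ≈ g ∙ θ h (x ⁻¹)
  ∙θ≈⇒≈∙θ⁻¹ {k} {g} h x kθx≈g =
    trans (x≈z//y k (θ h x) g kθx≈g) (∙-congˡ (sym (θ-⁻¹-homo h x)))

  orbit-injective : ∀ {S} → PreservesSet G H θ S → SimplyTransitiveOn G H θ S →
                    ∀ {s h h'} → S s → θ h s ≈ θ h' s → h H.≈ h'
  orbit-injective preserves simply-transitive {s} {h} {h'} s∈S θhs≈θh's =
    proj₂ (simply-transitive s (θ h s) s∈S (proj₁ (preserves h) s s∈S))
      h h' refl (sym θhs≈θh's)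

module Isomorphism (G H : Group 0ℓ 0ℓ)
    (S : Pred (Group.Carrier G) 0ℓ) (S-respects : Respects G S)
    (K : Pred (Group.Carrier G) 0ℓ) (K-subgroup : IsSubgroup G K) (K-index2 : HasIndex2 G K)
    (K∩S≡∅ : Disjoint G K S)
    (s₀ : Group.Carrier G) (s₀∈S : S s₀)
    (θ : Group.Carrier H → Group.Carrier G → Group.Carrier G)
    (action : IsAutAction G H θ) (preserves : PreservesSet G H θ S)
    (simply-transitive : SimplyTransitiveOn G H θ S)
    (T : Pred (Group.Carrier H) 0ℓ) where
  open Construction G H θ K S s₀ T
  private module H = Group H
  open Group G
  open GroupProperties G
  open IsSubgroup K-subgroup
  open SubgroupProperties G K-subgroup
  open AutActionProperties G H action
  open SetoidReasoning setoid

  θs₀∈S : ∀ h → S (θ h s₀)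
  θs₀∈S h = proj₁ (preserves h) s₀ s₀∈S

  θs₀-injective : ∀ {h h'} → θ h s₀ ≈ θ h' s₀ → h H.≈ h'
  θs₀-injective = orbit-injective preserves simply-transitive s₀∈S

  S⊆Ks₀ : ∀ {x} → S x → InKs₀ x
  S⊆Ks₀ {x} x∈S = ∉-index2⇒∙⁻¹∈ K-index2 (λ x∈K → K∩S≡∅ x x∈K x∈S) (λ s₀∈K → K∩S≡∅ s₀ s₀∈K s₀∈S)

  ∙θs₀∈Ks₀ : ∀ {k} h → K k → InKs₀ (k ∙ θ h s₀)
  ∙θs₀∈Ks₀ h k∈K = respects (sym (assoc _ _ _)) (∙∈ k∈K (S⊆Ks₀ (θs₀∈S h)))

  K∩Ks₀≡∅ : ∀ {g} → K g → InKs₀ g → ⊥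
  K∩Ks₀≡∅ g∈K gs₀⁻¹∈K = K∩S≡∅ s₀ (∙⁻¹∈⇒∈ g∈K gs₀⁻¹∈K) s₀∈S

  toEdge : VX → VΓ
  toEdge (k , k∈K , h) =
    (k , k ∙ θ h s₀) , k∈K , ∙θs₀∈Ks₀ h k∈K ,
    S-respects (sym (\\-leftDividesʳ k (θ h s₀))) (θs₀∈S h)

  toEdge-cong : Congruent _≈X_ _≈Γ_ toEdge
  toEdge-cong (k≈k' , h≈h') = k≈k' , ∙-cong k≈k' (θ-congʰ s₀ h≈h')

  toEdge-injective : Injective _≈X_ _≈Γ_ toEdge
  toEdge-injective {k , _ , _} (k≈k' , kθ≈k'θ) =
    k≈k' , θs₀-injective (∙-cancelˡ k _ _ (trans kθ≈k'θ (∙-congʳ (sym k≈k'))))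

  toEdge-surjective : Surjective _≈X_ _≈Γ_ toEdge
  toEdge-surjective ((a , b) , a∈K , _ , a⁻¹b∈S) =
    let (h , θhs₀≈a⁻¹b) = proj₁ (simply-transitive s₀ (a ⁻¹ ∙ b) s₀∈S a⁻¹b∈S) in
    (a , a∈K , h) , λ (k≈a , h'≈h) →
      k≈a , trans (∙-cong k≈a (trans (θ-congʰ s₀ h'≈h) θhs₀≈a⁻¹b)) (\\-leftDividesˡ a b)

  eRel-K-intro : ∀ {g h₀ k h} → K g → k ≈ g → h H.≈ h₀ → eRel g h₀ (k , k ∙ θ h s₀)
  eRel-K-intro g∈K k≈g h≈h₀ = inj₁ (g∈K , k≈g , ∙-cong k≈g (θ-congʰ s₀ h≈h₀))

  eRel-K-elim : ∀ {g h₀ k h} → K g → eRel g h₀ (k , k ∙ θ h s₀) → k ≈ g × h H.≈ h₀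
  eRel-K-elim {g} _ (inj₁ (_ , k≈g , kθ≈gθ)) =
    k≈g , θs₀-injective (∙-cancelˡ g _ _ (trans (∙-congʳ (sym k≈g)) kθ≈gθ))
  eRel-K-elim g∈K (inj₂ (g∈Ks₀ , _)) = ⊥-elim (K∩Ks₀≡∅ g∈K g∈Ks₀)

  eRel-Ks₀-intro : ∀ {g h₀ k h} → InKs₀ g → k ≈ g ∙ θ h₀ (s₀ ⁻¹) → h H.≈ h₀ →
                   eRel g h₀ (k , k ∙ θ h s₀)
  eRel-Ks₀-intro {h₀ = h₀} g∈Ks₀ k≈ h≈h₀ =
    inj₂ (g∈Ks₀ , k≈ , trans (∙-congˡ (θ-congʰ s₀ h≈h₀)) (≈∙θ⁻¹⇒∙θ≈ h₀ s₀ k≈))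

  eRel-Ks₀-elim : ∀ {g h₀ k h} → InKs₀ g → eRel g h₀ (k , k ∙ θ h s₀) →
                  k ≈ g ∙ θ h₀ (s₀ ⁻¹) × h H.≈ h₀
  eRel-Ks₀-elim g∈Ks₀ (inj₁ (g∈K , _)) = ⊥-elim (K∩Ks₀≡∅ g∈K g∈Ks₀)
  eRel-Ks₀-elim {h₀ = h₀} {k} _ (inj₂ (_ , k≈ , kθ≈g)) =
    k≈ , θs₀-injective (∙-cancelˡ k _ _ (trans kθ≈g (sym (≈∙θ⁻¹⇒∙θ≈ h₀ s₀ k≈))))

  Σ₁-step : ∀ {σ} k h → σ ≈ ε → k ∙ θ h σ ≈ k
  Σ₁-step k h σ≈ε = trans (∙-congˡ (trans (θ-cong h σ≈ε) (θ-ε-homo h))) (identityʳ k)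

  Σ₂-step : ∀ {σ} k h t → σ ≈ s₀ ∙ θ t (s₀ ⁻¹) →
            k ∙ θ h σ ≈ (k ∙ θ h s₀) ∙ θ (h H.∙ t) (s₀ ⁻¹)
  Σ₂-step {σ} k h t σ≈ = begin
    k ∙ θ h σ                              ≈⟨ ∙-congˡ (θ-cong h σ≈) ⟩
    k ∙ θ h (s₀ ∙ θ t (s₀ ⁻¹))             ≈⟨ ∙-congˡ (θ-∙-homo h s₀ _) ⟩
    k ∙ (θ h s₀ ∙ θ h (θ t (s₀ ⁻¹)))       ≈⟨ ∙-congˡ (∙-congˡ (θ-∙ʰ-homo h t _)) ⟨
    k ∙ (θ h s₀ ∙ θ (h H.∙ t) (s₀ ⁻¹))     ≈⟨ assoc k _ _ ⟨
    (k ∙ θ h s₀) ∙ θ (h H.∙ t) (s₀ ⁻¹)     ∎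

  edgeX⇒edgeΓ : ∀ x y → EdgeX x y → EdgeΓ (toEdge x) (toEdge y)
  edgeX⇒edgeΓ (k , k∈K , h) (k' , _ , h') (_ , inj₁ (t , t∈T , σ≈ε , σʰ≈t) , k'≈ , h'≈) =
    k , h , t , t∈T , eRel-K-intro k∈K refl H.refl ,
    eRel-K-intro k∈K (trans k'≈ (Σ₁-step k h σ≈ε)) (H.trans h'≈ (H.∙-congˡ σʰ≈t))
  edgeX⇒edgeΓ (k , k∈K , h) (k' , _ , h') (_ , inj₂ (t , t∈T , σ≈ , σʰ≈t) , k'≈ , h'≈) =
    k ∙ θ h s₀ , h , t , t∈T ,
    eRel-Ks₀-intro (∙θs₀∈Ks₀ h k∈K) (∙θ≈⇒≈∙θ⁻¹ h s₀ refl) H.refl ,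
    eRel-Ks₀-intro (∙θs₀∈Ks₀ h k∈K) (trans k'≈ (Σ₂-step k h t σ≈)) (H.trans h'≈ (H.∙-congˡ σʰ≈t))

  edgeΓ⇒edgeX : ∀ x y → EdgeΓ (toEdge x) (toEdge y) → EdgeX x y
  edgeΓ⇒edgeX (k , _ , h) (k' , _ , h') (g , h₀ , t , t∈T , e@(inj₁ (g∈K , _)) , e')
    with eRel-K-elim g∈K e | eRel-K-elim g∈K e'
  ... | k≈g , h≈h₀ | k'≈g , h'≈h₀t =
    (ε , t) , inj₁ (t , t∈T , refl , H.refl) ,
    trans k'≈g (trans (sym k≈g) (sym (Σ₁-step k h refl))) ,
    H.trans h'≈h₀t (H.∙-congʳ (H.sym h≈h₀))
  edgeΓ⇒edgeX (k , _ , h) (k' , _ , h') (g , h₀ , t , t∈T , e@(inj₂ (g∈Ks₀ , _)) , e')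
    with eRel-Ks₀-elim g∈Ks₀ e | eRel-Ks₀-elim g∈Ks₀ e'
  ... | k≈ , h≈h₀ | k'≈ , h'≈h₀t =
    (s₀ ∙ θ t (s₀ ⁻¹) , t) , inj₂ (t , t∈T , refl , H.refl) ,
    k'≈kθσ , H.trans h'≈h₀t (H.∙-congʳ (H.sym h≈h₀))
    where
    k'≈kθσ : k' ≈ k ∙ θ h (s₀ ∙ θ t (s₀ ⁻¹))
    k'≈kθσ = begin
      k'                                   ≈⟨ k'≈ ⟩
      g ∙ θ (h₀ H.∙ t) (s₀ ⁻¹)             ≈⟨ ∙-cong (≈∙θ⁻¹⇒∙θ≈ h₀ s₀ k≈)
                                                     (θ-congʰ _ (H.∙-congʳ h≈h₀)) ⟨
      (k ∙ θ h₀ s₀) ∙ θ (h H.∙ t) (s₀ ⁻¹)  ≈⟨ ∙-congʳ (∙-congˡ (θ-congʰ s₀ h≈h₀)) ⟨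
      (k ∙ θ h s₀) ∙ θ (h H.∙ t) (s₀ ⁻¹)   ≈⟨ Σ₂-step k h t refl ⟨
      k ∙ θ h (s₀ ∙ θ t (s₀ ⁻¹))           ∎

  toEdge-isGraphIso : IsGraphIso toEdge
  toEdge-isGraphIso =
    (λ {x} {y} → toEdge-cong {x} {y}) ,
    ((λ {x} {y} → toEdge-injective {x} {y}) , toEdge-surjective) ,
    λ x y → edgeX⇒edgeΓ x y , edgeΓ⇒edgeX x y

proposition3 : (G H : Group 0ℓ 0ℓ) → IsFiniteGroup G
    → (S : Pred (Group.Carrier G) 0ℓ) → Respects G S → IsSymmetric G S → Generates G S
    → (K : Pred (Group.Carrier G) 0ℓ) → IsSubgroup G K → HasIndex2 G K → Disjoint G K S
    → (s₀ : Group.Carrier G) → S s₀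
    → (θ : Group.Carrier H → Group.Carrier G → Group.Carrier G)
    → IsAutAction G H θ → PreservesSet G H θ S → SimplyTransitiveOn G H θ S
    → (T : Pred (Group.Carrier H) 0ℓ) → Respects H T
    → let open Construction G H θ K S s₀ T in
    Σ (VX → VΓ) λ f →
    (∀ k (kK : K k) h → pairΓ (f (k , kK , h)) ≈GG (k , Group._∙_ G k (θ h s₀)))
    × IsGraphIso f
proposition3 G H _ S S-respects _ _ K K-subgroup K-index2 K∩S≡∅ s₀ s₀∈S θ action preserves
             simply-transitive T _ =
  toEdge , (λ _ _ _ → G.refl , G.refl) , toEdge-isGraphIso
  where
  module G = Group G
  open Isomorphism G H S S-respects K K-subgroup K-index2 K∩S≡∅ s₀ s₀∈S θ action preserves
                   simply-transitive T
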